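{- For $N\ge 0$ let $a_N$ be the number of tilings of the $7\times \tfrac{4N}{7}$ rectangle by $1\times 4$ tiles when $4N/7$ is a positive integer, $a_N=0$ when $4N/7$ is not an integer, and $a_0=1$. Then $$\sum_{N\ge 0} a_N z^N=\frac{(1-z^7)^3}{1-8z^7+6z^{14}-4z^{21}+z^{28}} = 1+5z^7+37z^{14}+269z^{21}+1949z^{28}+\cdots.$$
   Context: A tiling of an $m\times n$ rectangle (made of $mn$ unit squares) by $a\times b$ tiles is a set of non-overlapping axis-parallel $a\times b$ or $b\times a$ rectangles with integer corners whose union is the rectangle; both orientations may be mixed. Tilings related by a symmetry of the rectangle are counted separately. The index $N$ is the number of tiles used. -}

module Defs where

open import Data.Bool using (Bool; true; false; if_then_else_; _∧_)
open import Data.Nat using (ℕ; zero; suc; _+_; _*_; _∸_; _≡ᵇ_; _<ᵇ_; _≤ᵇ_)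
open import Data.Nat.DivMod using (_/_; _%_)
open import Data.Integer as ℤ using (ℤ; +_; -_)
open import Data.List using (List; []; _∷_; map; _++_; concatMap; upTo; length)
open import Data.Product using (_×_; _,_)

-- An axis-parallel rectangle with integer corners: rows [row, row+height),
-- columns [col, col+width).
record Rect : Set where
  constructor rect
  field
    row col height width : ℕ

shapes : ℕ → ℕ → List (ℕ × ℕ)
shapes a b = if a ≡ᵇ b then (a , b) ∷ [] else (a , b) ∷ (b , a) ∷ []

placements : ℕ → ℕ → ℕ → ℕ → List Rect
placements m n a b =
  concatMap (λ { (h , w) →
    concatMap (λ r → map (λ c → rect r c h w) (upTo (suc n ∸ w)))
              (upTo (suc m ∸ h)) })
  (shapes a b)

covers : Rect → ℕ → ℕ → Bool
covers (rect r c h w) i j = (r ≤ᵇ i) ∧ (i <ᵇ r + h) ∧ (c ≤ᵇ j) ∧ (j <ᵇ c + w)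

count : {A : Set} → (A → Bool) → List A → ℕ
count p []       = 0
count p (x ∷ xs) = if p x then suc (count p xs) else count p xs

-- All sub-lists of a list (= all subsets, for a duplicate-free list).
sublists : {A : Set} → List A → List (List A)
sublists []       = [] ∷ []
sublists (x ∷ xs) = map (x ∷_) (sublists xs) ++ sublists xs

cells : ℕ → ℕ → List (ℕ × ℕ)
cells m n = concatMap (λ i → map (λ j → (i , j)) (upTo n)) (upTo m)

allᵇ : {A : Set} → (A → Bool) → List A → Bool
allᵇ p []       = true
allᵇ p (x ∷ xs) = p x ∧ allᵇ p xs

isTiling : ℕ → ℕ → List Rect → Bool
isTiling m n S = allᵇ (λ { (i , j) → count (λ t → covers t i j) S ≡ᵇ 1 }) (cells m n)

numTilings : ℕ → ℕ → ℕ → ℕ → ℕ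
numTilings m n a b = count (isTiling m n) (sublists (placements m n a b))

aSeq : ℕ → ℕ
aSeq zero = 1
aSeq (suc k) =
  if (4 * suc k) % 7 ≡ᵇ 0 then numTilings 7 ((4 * suc k) / 7) 1 4 else 0

-- Polynomials as coefficient lists (constant term first).
Poly : Set
Poly = List ℤ

coeff : Poly → ℕ → ℤ
coeff []       n       = + 0
coeff (c ∷ cs) zero    = c
coeff (c ∷ cs) (suc n) = coeff cs n

sumTo : ℕ → (ℕ → ℤ) → ℤ
sumTo zero    f = f 0
sumTo (suc n) f = sumTo n f ℤ.+ f (suc n)

mulCoeff : (ℕ → ℤ) → (ℕ → ℤ) → ℕ → ℤ
mulCoeff f g n = sumTo n (λ i → f i ℤ.* g (n ∸ i))

polyMul : Poly → Poly → Poly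
polyMul p q = map (mulCoeff (coeff p) (coeff q)) (upTo (length p + length q))

polyPow : Poly → ℕ → Poly
polyPow p zero    = + 1 ∷ []
polyPow p (suc k) = polyMul p (polyPow p k)

monomial : ℤ → ℕ → Poly
monomial c zero    = c ∷ []
monomial c (suc k) = + 0 ∷ monomial c k

polyAdd : Poly → Poly → Poly
polyAdd []       q        = q
polyAdd p        []       = p
polyAdd (x ∷ p)  (y ∷ q)  = (x ℤ.+ y) ∷ polyAdd p q

numer : Poly
numer = polyPow (polyAdd (monomial (+ 1) 0) (monomial (- (+ 1)) 7)) 3

denom : Poly
denom = polyAdd (monomial (+ 1) 0)
          (polyAdd (monomial (- (+ 8)) 7)
            (polyAdd (monomial (+ 6) 14)
              (polyAdd (monomial (- (+ 4)) 21) (monomial (+ 1) 28))))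

A : ℕ → ℤ
A N = + aSeq N

-- Cut a tiling of the 7 × n rectangle by 1 × 4 tiles along its columns. Once the
-- tiles meeting the first column are chosen, what is left is the rest of the
-- rectangle minus, in each row, the first 0 to 3 cells covered by a horizontal tile;
-- this profile is the state, and 52 states are reachable from the empty one. So
-- the numbers of tilings are entries of powers of a 52 × 52 transfer matrix M, and
-- the row vectors e Mʲ (e the empty state) satisfy e (M¹⁷ + 6 M⁹ + M) =
-- e (8 M¹³ + 4 M⁵), a finite computation. Hence the number t k of tilings of the
-- 7 × 4k rectangle satisfies t (k+4) − 8 t (k+3) + 6 t (k+2) − 4 t (k+1) + t k = 0,
-- with t 0, …, t 4 = 1, 5, 37, 269, 1949. As a_N is t (N / 7) when 7 ∣ N and 0
-- otherwise, and the denominator is a polynomial in z⁷, the recurrence says that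
-- the denominator times the series has no terms from z²⁸ on; the coefficients
-- below z²⁸ are checked by evaluation.

module Submission where

open import Defs

open import Algebra.Bundles using (CommutativeMonoid)
import Algebra.Properties.CommutativeSemigroup as CommutativeSemigroupProperties
open import Data.Bool using (Bool; true; false; if_then_else_; _∧_; _∨_; not; T)
import Data.Bool.Properties as Bool
open import Data.Bool.Properties using (∧-zeroʳ; ∧-assoc; ∧-commutativeMonoid)
open import Data.Fin as Fin using (Fin; toℕ; fromℕ<)
import Data.Fin.Properties as Fin
open import Data.Integer as ℤ using (ℤ; +_; -_)
import Data.Integer.Properties as ℤ
import Data.Integer.Tactic.RingSolver as ℤ-Solver
open import Data.List using (List; []; _∷_; _++_; map; concatMap; upTo; applyUpTo; filterᵇ)
open import Data.List.Properties
  using (map-∘; map-upTo; map-cong; map-cong-local; map-++; ++-assoc; map-concatMap; concatMap-cong)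
  renaming (≡-dec to ≡-decᴸ)
open import Data.List.Relation.Binary.Permutation.Propositional as ↭ using (_↭_; ↭-reflexive; ↭-trans)
import Data.List.Relation.Binary.Permutation.Propositional.Properties as ↭
open import Data.List.Relation.Binary.Permutation.Propositional.Properties using (++⁺ˡ; shifts)
open import Data.List.Relation.Unary.All as All using (All; []; _∷_)
open import Data.List.Relation.Unary.All.Properties using (++⁺; concat⁺; map⁺; applyUpTo⁺₁; applyUpTo⁺₂)
open import Data.Nat using (ℕ; zero; suc; _+_; _*_; _∸_; _≤_; _<_; _≤ᵇ_; _<ᵇ_; _≡ᵇ_; s≤s; z≤n)
open import Data.Nat.DivMod using (_/_; _%_; m≡m%n+[m/n]*n; m%n<n; [m+kn]%n≡m%n; m*n%n≡0; m*n/n≡m; m<n*o⇒m/o<n)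
open import Data.Nat.ListAction using (sum)
open import Data.Nat.ListAction.Properties using (sum-++)
open import Data.Nat.Properties
  using (_<?_; +-identityʳ; +-comm; +-suc; *-zeroʳ; *-assoc; *-distribˡ-+; *-distribʳ-+; +-commutativeSemigroup;
         ≤-refl; ≤-trans; ≤-<-trans; ≤-pred; n≤1+n; +-monoˡ-≤; ≮⇒≥; ≤ᵇ⇒≤; 0∸n≡0; m∸n≤m; m≤n⇒∃[o]m+o≡n)
open import Data.Nat.Tactic.RingSolver using (solve-∀)
open import Data.Product using (_×_; _,_; ∃)
open import Data.Sum using (_⊎_; inj₁; inj₂)
open import Data.Unit using (⊤; tt)
open import Data.Vec as Vec using (Vec; []; _∷_)
import Data.Vec.Properties as Vec
open import Data.Vec.Membership.Propositional using (_∈_)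
open import Data.Vec.Relation.Unary.Any using (here; there)
import Data.Vec.Relation.Unary.All as VecAll
open import Function using (_∘_)
open import Relation.Binary.PropositionalEquality
  using (_≡_; refl; sym; trans; cong; cong₂; subst; _≗_; module ≡-Reasoning)
open import Relation.Nullary using (yes; no; does; contradiction)
open import Relation.Nullary.Decidable using (from-yes)

open CommutativeSemigroupProperties +-commutativeSemigroup using () renaming (interchange to +-interchange)
open CommutativeSemigroupProperties (CommutativeMonoid.commutativeSemigroup ∧-commutativeMonoid)
  using () renaming (interchange to ∧-interchange)

count-++ : {X : Set} (p : X → Bool) (xs ys : List X) → count p (xs ++ ys) ≡ count p xs + count p ys
count-++ p []       ys = refl
count-++ p (x ∷ xs) ys with p x
... | true  = cong suc (count-++ p xs ys)
... | false = count-++ p xs ys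

count-map : {X Y : Set} (p : Y → Bool) (f : X → Y) (xs : List X) → count p (map f xs) ≡ count (p ∘ f) xs
count-map p f []       = refl
count-map p f (x ∷ xs) with p (f x)
... | true  = cong suc (count-map p f xs)
... | false = count-map p f xs

count-cong : {X : Set} {p q : X → Bool} → p ≗ q → count p ≗ count q
count-cong p≗q []       = refl
count-cong {q = q} p≗q (x ∷ xs) rewrite p≗q x with q x
... | true  = cong suc (count-cong p≗q xs)
... | false = count-cong p≗q xs

count-∧ˡ : {X : Set} (b : Bool) (p : X → Bool) (xs : List X) → count (λ x → b ∧ p x) xs ≡ (if b then count p xs else 0)
count-∧ˡ true  p xs       = refl
count-∧ˡ false p []       = refl
count-∧ˡ false p (x ∷ xs) = count-∧ˡ false p xs

count-false : {X : Set} (xs : List X) → count (λ _ → false) xs ≡ 0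
count-false []       = refl
count-false (x ∷ xs) = count-false xs

count-↭ : {X : Set} (p : X → Bool) {xs ys : List X} → xs ↭ ys → count p xs ≡ count p ys
count-↭ p ↭.refl = refl
count-↭ p (↭.prep x xs↭ys) with p x
... | true  = cong suc (count-↭ p xs↭ys)
... | false = count-↭ p xs↭ys
count-↭ p (↭.swap x y xs↭ys) with p x | p y
... | true  | true  = cong (suc ∘ suc) (count-↭ p xs↭ys)
... | true  | false = cong suc (count-↭ p xs↭ys)
... | false | true  = cong suc (count-↭ p xs↭ys)
... | false | false = count-↭ p xs↭ys
count-↭ p (↭.trans xs↭ys ys↭zs) = trans (count-↭ p xs↭ys) (count-↭ p ys↭zs)

count-sublists-∷ : {X : Set} (p : List X → Bool) (x : X) (xs : List X) →
  count p (sublists (x ∷ xs)) ≡ count (p ∘ (x ∷_)) (sublists xs) + count p (sublists xs)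
count-sublists-∷ p x xs =
  trans (count-++ p (map (x ∷_) (sublists xs)) (sublists xs))
        (cong (_+ count p (sublists xs)) (count-map p (x ∷_) (sublists xs)))

count-sublists-map : {X Y : Set} (p : List Y → Bool) (f : X → Y) (xs : List X) →
  count p (sublists (map f xs)) ≡ count (p ∘ map f) (sublists xs)
count-sublists-map p f []       = refl
count-sublists-map p f (x ∷ xs) = begin
  count p (sublists (f x ∷ map f xs))
    ≡⟨ count-sublists-∷ p (f x) (map f xs) ⟩
  count (p ∘ (f x ∷_)) (sublists (map f xs)) + count p (sublists (map f xs))
    ≡⟨ cong₂ _+_ (count-sublists-map (p ∘ (f x ∷_)) f xs) (count-sublists-map p f xs) ⟩
  count (p ∘ map f ∘ (x ∷_)) (sublists xs) + count (p ∘ map f) (sublists xs)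
    ≡⟨ count-sublists-∷ (p ∘ map f) x xs ⟨
  count (p ∘ map f) (sublists (x ∷ xs)) ∎
  where open ≡-Reasoning

count-sublists-↭ : {X : Set} (p : List X → Bool) → (∀ {S S′} → S ↭ S′ → p S ≡ p S′) →
  {xs ys : List X} → xs ↭ ys → count p (sublists xs) ≡ count p (sublists ys)
count-sublists-↭ p p-inv ↭.refl = refl
count-sublists-↭ p p-inv (↭.prep {xs} {ys} x xs↭ys) = begin
  count p (sublists (x ∷ xs))
    ≡⟨ count-sublists-∷ p x xs ⟩
  count (p ∘ (x ∷_)) (sublists xs) + count p (sublists xs)
    ≡⟨ cong₂ _+_ (count-sublists-↭ (p ∘ (x ∷_)) (p-inv ∘ ↭.prep x) xs↭ys) (count-sublists-↭ p p-inv xs↭ys) ⟩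
  count (p ∘ (x ∷_)) (sublists ys) + count p (sublists ys)
    ≡⟨ count-sublists-∷ p x ys ⟨
  count p (sublists (x ∷ ys)) ∎
  where open ≡-Reasoning
count-sublists-↭ {X} p p-inv (↭.swap {xs} {ys} x y xs↭ys) = begin
  count p (sublists (x ∷ y ∷ xs))
    ≡⟨ count-sublists-∷∷ x y xs ⟩
  (c (λ S → p (x ∷ y ∷ S)) xs + c (λ S → p (x ∷ S)) xs) + (c (λ S → p (y ∷ S)) xs + c p xs)
    ≡⟨ +-interchange (c (λ S → p (x ∷ y ∷ S)) xs) (c (λ S → p (x ∷ S)) xs) (c (λ S → p (y ∷ S)) xs) (c p xs) ⟩
  (c (λ S → p (x ∷ y ∷ S)) xs + c (λ S → p (y ∷ S)) xs) + (c (λ S → p (x ∷ S)) xs + c p xs)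
    ≡⟨ cong₂ _+_ (cong₂ _+_ (trans (count-cong (λ S → p-inv (↭.swap x y ↭.refl)) (sublists xs))
                                   (count-sublists-↭ _ (λ e → p-inv (↭.prep y (↭.prep x e))) xs↭ys))
                            (count-sublists-↭ _ (p-inv ∘ ↭.prep y) xs↭ys))
                 (cong₂ _+_ (count-sublists-↭ _ (p-inv ∘ ↭.prep x) xs↭ys) (count-sublists-↭ p p-inv xs↭ys)) ⟩
  (c (λ S → p (y ∷ x ∷ S)) ys + c (λ S → p (y ∷ S)) ys) + (c (λ S → p (x ∷ S)) ys + c p ys)
    ≡⟨ count-sublists-∷∷ y x ys ⟨
  count p (sublists (y ∷ x ∷ ys)) ∎
  where
  open ≡-Reasoning
  c : (List X → Bool) → List X → ℕ
  c q zs = count q (sublists zs)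
  count-sublists-∷∷ : ∀ u v zs → count p (sublists (u ∷ v ∷ zs))
    ≡ (c (λ S → p (u ∷ v ∷ S)) zs + c (λ S → p (u ∷ S)) zs) + (c (λ S → p (v ∷ S)) zs + c p zs)
  count-sublists-∷∷ u v zs =
    trans (count-sublists-∷ p u (v ∷ zs))
          (cong₂ _+_ (count-sublists-∷ (p ∘ (u ∷_)) v zs) (count-sublists-∷ p v zs))
count-sublists-↭ p p-inv (↭.trans xs↭ys ys↭zs) =
  trans (count-sublists-↭ p p-inv xs↭ys) (count-sublists-↭ p p-inv ys↭zs)

allᵇ-++ : {X : Set} (p : X → Bool) (xs ys : List X) → allᵇ p (xs ++ ys) ≡ allᵇ p xs ∧ allᵇ p ys
allᵇ-++ p []       ys = refl
allᵇ-++ p (x ∷ xs) ys = trans (cong (p x ∧_) (allᵇ-++ p xs ys)) (sym (∧-assoc (p x) _ _))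

allᵇ-map : {X Y : Set} (p : Y → Bool) (f : X → Y) (xs : List X) → allᵇ p (map f xs) ≡ allᵇ (p ∘ f) xs
allᵇ-map p f []       = refl
allᵇ-map p f (x ∷ xs) = cong (p (f x) ∧_) (allᵇ-map p f xs)

allᵇ-concatMap : {X Y : Set} (p : Y → Bool) (f : X → List Y) (xs : List X) →
  allᵇ p (concatMap f xs) ≡ allᵇ (allᵇ p ∘ f) xs
allᵇ-concatMap p f []       = refl
allᵇ-concatMap p f (x ∷ xs) = trans (allᵇ-++ p (f x) (concatMap f xs)) (cong (allᵇ p (f x) ∧_) (allᵇ-concatMap p f xs))

allᵇ-∧ : {X : Set} (p q : X → Bool) (xs : List X) → allᵇ (λ x → p x ∧ q x) xs ≡ allᵇ p xs ∧ allᵇ q xs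
allᵇ-∧ p q []       = refl
allᵇ-∧ p q (x ∷ xs) = trans (cong ((p x ∧ q x) ∧_) (allᵇ-∧ p q xs)) (∧-interchange (p x) (q x) (allᵇ p xs) (allᵇ q xs))

allᵇ-cong : {X : Set} {p q : X → Bool} → p ≗ q → allᵇ p ≗ allᵇ q
allᵇ-cong p≗q []       = refl
allᵇ-cong p≗q (x ∷ xs) = cong₂ _∧_ (p≗q x) (allᵇ-cong p≗q xs)

allᵇ-true : {X : Set} {p : X → Bool} → (∀ x → p x ≡ true) → ∀ xs → allᵇ p xs ≡ true
allᵇ-true p-true []       = refl
allᵇ-true p-true (x ∷ xs) rewrite p-true x = allᵇ-true p-true xs

x∧y∧false≡false : ∀ x y → x ∧ y ∧ false ≡ false
x∧y∧false≡false x y = trans (cong (x ∧_) (∧-zeroʳ y)) (∧-zeroʳ x)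

≤⇒≮ᵇ : ∀ {m n} → n ≤ m → (m <ᵇ n) ≡ false
≤⇒≮ᵇ z≤n       = refl
≤⇒≮ᵇ (s≤s n≤m) = ≤⇒≮ᵇ n≤m

≮ᵇ⇒≥ : ∀ m n → (m <ᵇ n) ≡ false → n ≤ m
≮ᵇ⇒≥ m       zero    _     = z≤n
≮ᵇ⇒≥ (suc m) (suc n) m≮ᵇn = s≤s (≮ᵇ⇒≥ m n m≮ᵇn)

m≤ᵇn≡m<ᵇ1+n : ∀ m n → (m ≤ᵇ n) ≡ (m <ᵇ suc n)
m≤ᵇn≡m<ᵇ1+n zero    n = refl
m≤ᵇn≡m<ᵇ1+n (suc m) n = refl

concatMap-++-↭ : {X Y : Set} (f g : X → List Y) (xs : List X) →
  concatMap (λ x → f x ++ g x) xs ↭ concatMap f xs ++ concatMap g xs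
concatMap-++-↭ f g []       = ↭.refl
concatMap-++-↭ f g (x ∷ xs) = begin
  (f x ++ g x) ++ concatMap (λ x → f x ++ g x) xs ↭⟨ ++⁺ˡ (f x ++ g x) (concatMap-++-↭ f g xs) ⟩
  (f x ++ g x) ++ (concatMap f xs ++ concatMap g xs) ≡⟨ ++-assoc (f x) (g x) _ ⟩
  f x ++ (g x ++ (concatMap f xs ++ concatMap g xs)) ↭⟨ ++⁺ˡ (f x) (shifts (g x) (concatMap f xs)) ⟩
  f x ++ (concatMap f xs ++ (g x ++ concatMap g xs)) ≡⟨ ++-assoc (f x) (concatMap f xs) _ ⟨
  (f x ++ concatMap f xs) ++ (g x ++ concatMap g xs) ∎
  where open ↭.PermutationReasoning

concatMap-↭ : {X Y : Set} {f g : X → List Y} → (∀ x → f x ↭ g x) → ∀ xs → concatMap f xs ↭ concatMap g xs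
concatMap-↭ f↭g []       = ↭.refl
concatMap-↭ f↭g (x ∷ xs) = ↭.++⁺ (f↭g x) (concatMap-↭ f↭g xs)

upTo-suc-∸ : ∀ k w → upTo (suc k ∸ w) ≡ (if w ≤ᵇ k then 0 ∷ [] else []) ++ map suc (upTo (k ∸ w))
upTo-suc-∸ k       zero    = cong (0 ∷_) (sym (map-upTo suc k))
upTo-suc-∸ zero    (suc w) = cong upTo (0∸n≡0 w)
upTo-suc-∸ (suc k) (suc w) =
  trans (upTo-suc-∸ k w) (cong (λ b → (if b then 0 ∷ [] else []) ++ map suc (upTo (k ∸ w))) (m≤ᵇn≡m<ᵇ1+n w k))

lookupOr : {X : Set} → X → List X → ℕ → X
lookupOr d []       i       = d
lookupOr d (x ∷ xs) zero    = x
lookupOr d (x ∷ xs) (suc i) = lookupOr d xs i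

lookupOr-applyUpTo : {X : Set} (d : X) (f : ℕ → X) (n i : ℕ) →
  lookupOr d (applyUpTo f n) i ≡ (if i <ᵇ n then f i else d)
lookupOr-applyUpTo d f zero    i       = refl
lookupOr-applyUpTo d f (suc n) zero    = refl
lookupOr-applyUpTo d f (suc n) (suc i) = lookupOr-applyUpTo d (f ∘ suc) n i

-- Exact covers of regions, column by column

Region : Set
Region = ℕ → ℕ → Bool

dropColumn : Region → Region
dropColumn f i j = f i (suc j)

remove : Region → Rect → Region
remove f x i j = f i j ∧ not (covers x i j)

shiftTile : Rect → Rect
shiftTile (rect r c h w) = rect r (suc c) h w

covers-shiftTile : ∀ x i j → covers (shiftTile x) i (suc j) ≡ covers x i j
covers-shiftTile (rect r zero    h w) i j = refl
covers-shiftTile (rect r (suc c) h w) i j = refl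

covers-shiftTile-0 : ∀ x i → covers (shiftTile x) i 0 ≡ false
covers-shiftTile-0 (rect r c h w) i = x∧y∧false≡false (r ≤ᵇ i) (i <ᵇ r + h)

covers-below : ∀ r c h w i j → r + h ≤ i → covers (rect r c h w) i j ≡ false
covers-below r c h w i j r+h≤i rewrite ≤⇒≮ᵇ r+h≤i = ∧-zeroʳ (r ≤ᵇ i)

covers-right : ∀ r h w i j → w ≤ j → covers (rect r 0 h w) i j ≡ false
covers-right r h w i j w≤j rewrite ≤⇒≮ᵇ w≤j = x∧y∧false≡false (r ≤ᵇ i) (i <ᵇ r + h)

data LeftAligned (n : ℕ) : Rect → Set where
  leftAligned : ∀ {r h w} → w ≤ n → LeftAligned n (rect r 0 h w)

module ExactCover (height : ℕ) where

  column : (ℕ → Bool) → Bool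
  column p = allᵇ p (upTo height)

  everyCell : ℕ → Region → Bool
  everyCell zero    p = true
  everyCell (suc n) p = column (λ i → p i 0) ∧ everyCell n (dropColumn p)

  everyCell-∧ : ∀ n (p q : Region) → everyCell n (λ i j → p i j ∧ q i j) ≡ everyCell n p ∧ everyCell n q
  everyCell-∧ zero    p q = refl
  everyCell-∧ (suc n) p q =
    trans (cong₂ _∧_ (allᵇ-∧ (λ i → p i 0) (λ i → q i 0) (upTo height)) (everyCell-∧ n (dropColumn p) (dropColumn q)))
          (∧-interchange (column (λ i → p i 0)) (column (λ i → q i 0)) _ _)

  everyCell-cong : ∀ n {p q : Region} → (∀ i j → p i j ≡ q i j) → everyCell n p ≡ everyCell n q
  everyCell-cong zero    p≡q = refl
  everyCell-cong (suc n) p≡q =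
    cong₂ _∧_ (allᵇ-cong (λ i → p≡q i 0) (upTo height)) (everyCell-cong n (λ i j → p≡q i (suc j)))

  everyCell-true : ∀ n {p : Region} → (∀ i j → p i j ≡ true) → everyCell n p ≡ true
  everyCell-true zero    p-true = refl
  everyCell-true (suc n) p-true rewrite allᵇ-true (λ i → p-true i 0) (upTo height) =
    everyCell-true n (λ i j → p-true i (suc j))

  rows≡columns : ∀ n (f : ℕ → ℕ) (p : Region) →
    allᵇ (λ i → allᵇ (p i) (applyUpTo f n)) (upTo height) ≡ everyCell n (λ i j → p i (f j))
  rows≡columns zero    f p = allᵇ-true (λ i → refl) (upTo height)
  rows≡columns (suc n) f p =
    trans (allᵇ-∧ (λ i → p i (f 0)) (λ i → allᵇ (p i) (applyUpTo (f ∘ suc) n)) (upTo height))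
          (cong (column (λ i → p i (f 0)) ∧_) (rows≡columns n (f ∘ suc) p))

  exactCover : ℕ → Region → List Rect → Bool
  exactCover n f S = everyCell n (λ i j → count (λ x → covers x i j) S ≡ᵇ (if f i j then 1 else 0))

  fits : ℕ → Rect → Region → Bool
  fits n x f = everyCell n (λ i j → not (covers x i j) ∨ f i j)

  columnClear : Region → Bool
  columnClear f = column (λ i → not (f i 0))

  isTiling≡exactCover : ∀ n S → isTiling height n S ≡ exactCover n (λ _ _ → true) S
  isTiling≡exactCover n S = begin
    allᵇ (λ { (i , j) → p i j }) (cells height n)
      ≡⟨ allᵇ-concatMap (λ { (i , j) → p i j }) (λ i → map (i ,_) (upTo n)) (upTo height) ⟩
    allᵇ (λ i → allᵇ (λ { (i , j) → p i j }) (map (i ,_) (upTo n))) (upTo height)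
      ≡⟨ allᵇ-cong (λ i → allᵇ-map (λ { (i , j) → p i j }) (i ,_) (upTo n)) (upTo height) ⟩
    allᵇ (λ i → allᵇ (p i) (upTo n)) (upTo height)
      ≡⟨ rows≡columns n (λ j → j) p ⟩
    everyCell n p ∎
    where
    open ≡-Reasoning
    p : Region
    p i j = count (λ x → covers x i j) S ≡ᵇ 1

  exactCover-∷ : ∀ n f x S → exactCover n f (x ∷ S) ≡ fits n x f ∧ exactCover n (remove f x) S
  exactCover-∷ n f x S =
    trans (everyCell-cong n (λ i j → cell (count (λ y → covers y i j) S) (covers x i j) (f i j))) (everyCell-∧ n _ _)
    where
    cell : ∀ k c b → ((if c then suc k else k) ≡ᵇ (if b then 1 else 0))
                     ≡ (not c ∨ b) ∧ (k ≡ᵇ (if b ∧ not c then 1 else 0))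
    cell k true  true  = refl
    cell k true  false = refl
    cell k false true  = refl
    cell k false false = refl

  exactCover-↭ : ∀ n f {S S′} → S ↭ S′ → exactCover n f S ≡ exactCover n f S′
  exactCover-↭ n f S↭S′ = everyCell-cong n (λ i j → cong (_≡ᵇ _) (count-↭ (λ x → covers x i j) S↭S′))

  exactCover-cong : ∀ n {f g : Region} → (∀ i j → f i j ≡ g i j) → ∀ S → exactCover n f S ≡ exactCover n g S
  exactCover-cong n f≡g S =
    everyCell-cong n (λ i j → cong (λ b → count (λ x → covers x i j) S ≡ᵇ (if b then 1 else 0)) (f≡g i j))

  exactCover-shift : ∀ n f S →
    exactCover (suc n) f (map shiftTile S) ≡ columnClear f ∧ exactCover n (dropColumn f) S
  exactCover-shift n f S = cong₂ _∧_
    (allᵇ-cong (λ i → trans (cong (_≡ᵇ _) (uncovered i)) (nothing-needed (f i 0))) (upTo height))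
    (everyCell-cong n (λ i j → cong (_≡ᵇ _)
      (trans (count-map (λ x → covers x i (suc j)) shiftTile S) (count-cong (λ x → covers-shiftTile x i j) S))))
    where
    uncovered : ∀ i → count (λ x → covers x i 0) (map shiftTile S) ≡ 0
    uncovered i = trans (count-map (λ x → covers x i 0) shiftTile S)
                        (trans (count-cong (λ x → covers-shiftTile-0 x i) S) (count-false S))
    nothing-needed : ∀ b → (0 ≡ᵇ (if b then 1 else 0)) ≡ not b
    nothing-needed true  = refl
    nothing-needed false = refl

  fits-width : ∀ {n} r h w f → w ≤ n → fits n (rect r 0 h w) f ≡ fits w (rect r 0 h w) f
  fits-width {n}     r h zero    f _         =
    everyCell-true n (λ i j → cong (λ c → not c ∨ f i j) (covers-right r h 0 i j z≤n))
  fits-width {suc n} r h (suc w) f (s≤s w≤n) = cong (_ ∧_) (fits-width r h w (dropColumn f) w≤n)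

  fillings : List Rect → Region → List Region
  fillings []       f = f ∷ []
  fillings (x ∷ xs) f = (if fits (Rect.width x) x f then fillings xs (remove f x) else []) ++ fillings xs f

  completions : ℕ → List Rect → Region → ℕ
  completions n L g = if columnClear g then count (exactCover n (dropColumn g)) (sublists L) else 0

  count-exactCover-firstColumn : ∀ n xs L f → All (LeftAligned (suc n)) xs →
    count (exactCover (suc n) f) (sublists (xs ++ map shiftTile L)) ≡ sum (map (completions n L) (fillings xs f))
  count-exactCover-firstColumn n [] L f [] = begin
    count (exactCover (suc n) f) (sublists (map shiftTile L))
      ≡⟨ count-sublists-map (exactCover (suc n) f) shiftTile L ⟩
    count (exactCover (suc n) f ∘ map shiftTile) (sublists L)
      ≡⟨ count-cong (exactCover-shift n f) (sublists L) ⟩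
    count (λ S → columnClear f ∧ exactCover n (dropColumn f) S) (sublists L)
      ≡⟨ count-∧ˡ (columnClear f) (exactCover n (dropColumn f)) (sublists L) ⟩
    completions n L f
      ≡⟨ +-identityʳ (completions n L f) ⟨
    completions n L f + 0 ∎
    where open ≡-Reasoning
  count-exactCover-firstColumn n (x@(rect r 0 h w) ∷ xs) L f (leftAligned w≤1+n ∷ aligned) = begin
    count (exactCover (suc n) f) (sublists (x ∷ R))
      ≡⟨ count-sublists-∷ (exactCover (suc n) f) x R ⟩
    count (exactCover (suc n) f ∘ (x ∷_)) (sublists R) + withoutX
      ≡⟨ cong (_+ withoutX) (count-cong (exactCover-∷ (suc n) f x) (sublists R)) ⟩
    count (λ S → fits (suc n) x f ∧ exactCover (suc n) (remove f x) S) (sublists R) + withoutX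
      ≡⟨ cong (_+ withoutX) (count-∧ˡ (fits (suc n) x f) (exactCover (suc n) (remove f x)) (sublists R)) ⟩
    (if fits (suc n) x f then withX else 0) + withoutX
      ≡⟨ cong (λ b → (if b then withX else 0) + withoutX) (fits-width r h w f w≤1+n) ⟩
    (if fits w x f then withX else 0) + withoutX
      ≡⟨ cong₂ (λ a b → (if fits w x f then a else 0) + b)
               (count-exactCover-firstColumn n xs L (remove f x) aligned) (count-exactCover-firstColumn n xs L f aligned) ⟩
    (if fits w x f then total (fillings xs (remove f x)) else 0) + total (fillings xs f)
      ≡⟨ cong (_+ total (fillings xs f)) (total-if (fits w x f)) ⟩
    total (if fits w x f then fillings xs (remove f x) else []) + total (fillings xs f)
      ≡⟨ total-++ (if fits w x f then fillings xs (remove f x) else []) (fillings xs f) ⟨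
    total (fillings (x ∷ xs) f) ∎
    where
    open ≡-Reasoning
    R : List Rect
    R = xs ++ map shiftTile L
    withX withoutX : ℕ
    withX    = count (exactCover (suc n) (remove f x)) (sublists R)
    withoutX = count (exactCover (suc n) f) (sublists R)
    total : List Region → ℕ
    total gs = sum (map (completions n L) gs)
    total-if : ∀ b {gs} → (if b then total gs else 0) ≡ total (if b then gs else [])
    total-if true  = refl
    total-if false = refl
    total-++ : ∀ gs hs → total (gs ++ hs) ≡ total gs + total hs
    total-++ gs hs =
      trans (cong sum (map-++ (completions n L) gs hs)) (sum-++ (map (completions n L) gs) (map (completions n L) hs))

concatMap-shiftTile-↭ : {X : Set} (f g : X → List Rect) (xs : List X) →
  concatMap (λ x → f x ++ map shiftTile (g x)) xs ↭ concatMap f xs ++ map shiftTile (concatMap g xs)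
concatMap-shiftTile-↭ f g xs =
  ↭-trans (concatMap-++-↭ f (map shiftTile ∘ g) xs)
          (↭-reflexive (cong (concatMap f xs ++_) (sym (map-concatMap shiftTile g xs))))

rowPlacements : ℕ → ℕ → ℕ → ℕ → List Rect
rowPlacements n h w r = map (λ c → rect r c h w) (upTo (suc n ∸ w))

rowPlacements-suc : ∀ n h w r →
  rowPlacements (suc n) h w r ≡ (if w ≤ᵇ suc n then rect r 0 h w ∷ [] else []) ++ map shiftTile (rowPlacements n h w r)
rowPlacements-suc n h w r = begin
  map tile (upTo (suc (suc n) ∸ w))
    ≡⟨ cong (map tile) (upTo-suc-∸ (suc n) w) ⟩
  map tile ((if w ≤ᵇ suc n then 0 ∷ [] else []) ++ map suc (upTo (suc n ∸ w)))
    ≡⟨ map-++ tile (if w ≤ᵇ suc n then 0 ∷ [] else []) _ ⟩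
  map tile (if w ≤ᵇ suc n then 0 ∷ [] else []) ++ map tile (map suc (upTo (suc n ∸ w)))
    ≡⟨ cong₂ _++_ (map-if (w ≤ᵇ suc n)) (trans (sym (map-∘ (upTo (suc n ∸ w)))) (map-∘ (upTo (suc n ∸ w)))) ⟩
  (if w ≤ᵇ suc n then rect r 0 h w ∷ [] else []) ++ map shiftTile (map tile (upTo (suc n ∸ w))) ∎
  where
  open ≡-Reasoning
  tile : ℕ → Rect
  tile c = rect r c h w
  map-if : ∀ b → map tile (if b then 0 ∷ [] else []) ≡ (if b then tile 0 ∷ [] else [])
  map-if true  = refl
  map-if false = refl

column₀ : ℕ → ℕ → ℕ → ℕ → List Rect
column₀ m n a b =
  concatMap (λ { (h , w) → concatMap (λ r → if w ≤ᵇ n then rect r 0 h w ∷ [] else []) (upTo (suc m ∸ h)) }) (shapes a b)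

placements-suc : ∀ m n a b → placements m (suc n) a b ↭ column₀ m (suc n) a b ++ map shiftTile (placements m n a b)
placements-suc m n a b = begin
  placements m (suc n) a b
    ≡⟨ concatMap-cong (λ { (h , w) → concatMap-cong (rowPlacements-suc n h w) (rows h) }) (shapes a b) ⟩
  concatMap (λ { (h , w) → concatMap (λ r → first h w r ++ map shiftTile (rowPlacements n h w r)) (rows h) }) (shapes a b)
    ↭⟨ concatMap-↭ (λ { (h , w) → concatMap-shiftTile-↭ (first h w) (rowPlacements n h w) (rows h) }) (shapes a b) ⟩
  concatMap (λ { (h , w) → concatMap (first h w) (rows h) ++ map shiftTile (concatMap (rowPlacements n h w) (rows h)) })
            (shapes a b)
    ↭⟨ concatMap-shiftTile-↭ _ _ (shapes a b) ⟩
  column₀ m (suc n) a b ++ map shiftTile (placements m n a b) ∎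
  where
  open ↭.PermutationReasoning
  rows : ℕ → List ℕ
  rows h = upTo (suc m ∸ h)
  first : ℕ → ℕ → ℕ → List Rect
  first h w r = if w ≤ᵇ suc n then rect r 0 h w ∷ [] else []

column₀-shape⁺ : ∀ {P : Rect → Set} b h w k → (T b → ∀ {r} → r < k → P (rect r 0 h w)) →
  All P (concatMap (λ r → if b then rect r 0 h w ∷ [] else []) (upTo k))
column₀-shape⁺ true  h w k P-rect = concat⁺ (map⁺ (applyUpTo⁺₁ _ k (λ r<k → P-rect _ r<k ∷ [])))
column₀-shape⁺ false h w k P-rect = concat⁺ (map⁺ (applyUpTo⁺₂ _ k (λ _ → [])))

column₀-leftAligned : ∀ m n a b → All (LeftAligned n) (column₀ m n a b)
column₀-leftAligned m n a b = concat⁺ (map⁺ {xs = shapes a b} (All.tabulate λ { {h , w} _ →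
  column₀-shape⁺ (w ≤ᵇ n) h w (suc m ∸ h) (λ w≤n _ → leftAligned (≤ᵇ⇒≤ w n w≤n)) }))

-- States of a 7-row strip

open ExactCover 7

OutsideWindow : ℕ → ℕ → Set
OutsideWindow i j = 7 ≤ i ⊎ 4 ≤ j

InWindow : Rect → Set
InWindow x = ∀ i j → OutsideWindow i j → covers x i j ≡ false

TrueOutsideWindow : Region → Set
TrueOutsideWindow g = ∀ i j → OutsideWindow i j → g i j ≡ true

inWindow : ∀ r h w → r + h ≤ 7 → w ≤ 4 → InWindow (rect r 0 h w)
inWindow r h w r+h≤7 w≤4 i j (inj₁ 7≤i) = covers-below r 0 h w i j (≤-trans r+h≤7 7≤i)
inWindow r h w r+h≤7 w≤4 i j (inj₂ 4≤j) = covers-right r h w i j (≤-trans w≤4 4≤j)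

column₀-inWindow : ∀ n → All InWindow (column₀ 7 n 1 4)
column₀-inWindow n =
  ++⁺ (column₀-shape⁺ (4 ≤ᵇ n) 1 4 7 (λ _ {r} r<7 → inWindow r 1 4 (subst (_≤ 7) (+-comm 1 r) r<7) ≤-refl))
      (++⁺ (column₀-shape⁺ (1 ≤ᵇ n) 4 1 4 (λ _ {r} r<4 → inWindow r 4 1 (≤-pred (+-monoˡ-≤ 4 r<4)) (s≤s z≤n))) [])

-- A state records which cells of the 7 rows and the next three columns remain to
-- be covered; every cell outside this window does.
State : Set
State = List (List Bool)

region : State → Region
region s i j = if (i <ᵇ 7) ∧ (j <ᵇ 3) then lookupOr true (lookupOr [] s i) j else true

stateOf : Region → State
stateOf g = applyUpTo (λ i → applyUpTo (λ j → g i (suc j)) 3) 7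

region-trueOutside : ∀ s → TrueOutsideWindow (region s)
region-trueOutside s i j (inj₁ 7≤i) rewrite ≤⇒≮ᵇ 7≤i = refl
region-trueOutside s i j (inj₂ 4≤j) rewrite ≤⇒≮ᵇ (≤-trans (n≤1+n 3) 4≤j) | ∧-zeroʳ (i <ᵇ 7) = refl

region-stateOf : ∀ g → TrueOutsideWindow g → ∀ i j → region (stateOf g) i j ≡ dropColumn g i j
region-stateOf g outside i j with i <ᵇ 7 in i<7 | j <ᵇ 3 in j<3
... | false | _     = sym (outside i (suc j) (inj₁ (≮ᵇ⇒≥ i 7 i<7)))
... | true  | false = sym (outside i (suc j) (inj₂ (s≤s (≮ᵇ⇒≥ j 3 j<3))))
... | true  | true
  rewrite lookupOr-applyUpTo [] (λ i → applyUpTo (λ j → g i (suc j)) 3) 7 i | i<7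
        | lookupOr-applyUpTo true (λ j → g i (suc j)) 3 j | j<3 = refl

remove-trueOutside : ∀ f x → TrueOutsideWindow f → InWindow x → TrueOutsideWindow (remove f x)
remove-trueOutside f x outside inWin i j out rewrite outside i j out | inWin i j out = refl

fillings-trueOutside : ∀ {f} xs → All InWindow xs → TrueOutsideWindow f →
  All TrueOutsideWindow (fillings xs f)
fillings-trueOutside         []       []                 outside = outside ∷ []
fillings-trueOutside {f} (x ∷ xs) (inWin ∷ inWins) outside = ++⁺ fitted (fillings-trueOutside xs inWins outside)
  where
  fitted : All TrueOutsideWindow (if fits (Rect.width x) x f then fillings xs (remove f x) else [])
  fitted with fits (Rect.width x) x f
  ... | true  = fillings-trueOutside xs inWins (remove-trueOutside f x outside inWin)
  ... | false = []

successors : ℕ → State → List State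
successors n s = map stateOf (filterᵇ columnClear (fillings (column₀ 7 n 1 4) (region s)))

sum-map-stateOf-clear : ∀ (G : State → ℕ) gs →
  sum (map G (map stateOf (filterᵇ columnClear gs))) ≡ sum (map (λ g → if columnClear g then G (stateOf g) else 0) gs)
sum-map-stateOf-clear G []       = refl
sum-map-stateOf-clear G (g ∷ gs) with columnClear g
... | true  = cong (_+_ (G (stateOf g))) (sum-map-stateOf-clear G gs)
... | false = sum-map-stateOf-clear G gs

tilingsFrom : ℕ → State → ℕ
tilingsFrom n s = count (exactCover n (region s)) (sublists (placements 7 n 1 4))

tilingsFrom-suc : ∀ n s → tilingsFrom (suc n) s ≡ sum (map (tilingsFrom n) (successors (suc n) s))
tilingsFrom-suc n s = begin
  count (exactCover (suc n) (region s)) (sublists (placements 7 (suc n) 1 4))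
    ≡⟨ count-sublists-↭ (exactCover (suc n) (region s)) (exactCover-↭ (suc n) (region s)) (placements-suc 7 n 1 4) ⟩
  count (exactCover (suc n) (region s)) (sublists (column₀ 7 (suc n) 1 4 ++ map shiftTile P))
    ≡⟨ count-exactCover-firstColumn n (column₀ 7 (suc n) 1 4) P (region s) (column₀-leftAligned 7 (suc n) 1 4) ⟩
  sum (map (completions n P) gs)
    ≡⟨ cong sum (map-cong-local (All.map agree gs-trueOutside)) ⟩
  sum (map (λ g → if columnClear g then tilingsFrom n (stateOf g) else 0) gs)
    ≡⟨ sum-map-stateOf-clear (tilingsFrom n) gs ⟨
  sum (map (tilingsFrom n) (successors (suc n) s)) ∎
  where
  open ≡-Reasoning
  P : List Rect
  P = placements 7 n 1 4
  gs : List Region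
  gs = fillings (column₀ 7 (suc n) 1 4) (region s)
  gs-trueOutside : All TrueOutsideWindow gs
  gs-trueOutside = fillings-trueOutside _ (column₀-inWindow (suc n)) (region-trueOutside s)
  agree : ∀ {g} → TrueOutsideWindow g → completions n P g ≡ (if columnClear g then tilingsFrom n (stateOf g) else 0)
  agree {g} outside = cong (if columnClear g then_else 0)
    (count-cong (exactCover-cong n (λ i j → sym (region-stateOf g outside i j))) (sublists P))

countColumns : ℕ → State → ℕ
countColumns zero    s = 1
countColumns (suc n) s = sum (map (countColumns n) (successors (suc n) s))

tilingsFrom≡countColumns : ∀ n s → tilingsFrom n s ≡ countColumns n s
tilingsFrom≡countColumns zero    s = refl
tilingsFrom≡countColumns (suc n) s =
  trans (tilingsFrom-suc n s) (cong sum (map-cong (tilingsFrom≡countColumns n) (successors (suc n) s)))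

emptyState : State
emptyState = stateOf (λ _ _ → true)

numTilings≡countColumns : ∀ n → numTilings 7 n 1 4 ≡ countColumns n emptyState
numTilings≡countColumns n =
  trans (count-cong everywhere (sublists (placements 7 n 1 4))) (tilingsFrom≡countColumns n emptyState)
  where
  everywhere : ∀ S → isTiling 7 n S ≡ exactCover n (region emptyState) S
  everywhere S = trans (isTiling≡exactCover n S)
                       (exactCover-cong n (λ i j → sym (region-stateOf (λ _ _ → true) (λ _ _ _ → refl) i j)) S)

infixl 6 _⊕_
infixr 7 _⊛_

_⊕_ : ∀ {n} → Vec ℕ n → Vec ℕ n → Vec ℕ n
_⊕_ = Vec.zipWith _+_

-- Matching on the scalar evaluates it once, before it is copied into every entry;
-- otherwise normalising rowPower j takes time exponential in j.
_⊛_ : ∀ {n} → ℕ → Vec ℕ n → Vec ℕ n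
zero  ⊛ v = Vec.replicate _ 0
suc c ⊛ v = Vec.map (suc c *_) v

dot : ∀ {n} → Vec ℕ n → Vec ℕ n → ℕ
dot []      []      = 0
dot (a ∷ u) (b ∷ v) = a * b + dot u v

rowCombination : ∀ {k n} → Vec ℕ k → Vec (Vec ℕ n) k → Vec ℕ n
rowCombination []       []       = Vec.replicate _ 0
rowCombination (c ∷ cs) (r ∷ rs) = c ⊛ r ⊕ rowCombination cs rs

dot-zeroˡ : ∀ {n} (v : Vec ℕ n) → dot (Vec.replicate n 0) v ≡ 0
dot-zeroˡ []      = refl
dot-zeroˡ (b ∷ v) = dot-zeroˡ v

dot-⊕ˡ : ∀ {n} (u u′ v : Vec ℕ n) → dot (u ⊕ u′) v ≡ dot u v + dot u′ v
dot-⊕ˡ []      []        []      = refl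
dot-⊕ˡ (a ∷ u) (a′ ∷ u′) (b ∷ v) = begin
  (a + a′) * b + dot (u ⊕ u′) v    ≡⟨ cong₂ _+_ (*-distribʳ-+ b a a′) (dot-⊕ˡ u u′ v) ⟩
  (a * b + a′ * b) + (dot u v + dot u′ v) ≡⟨ +-interchange (a * b) (a′ * b) (dot u v) (dot u′ v) ⟩
  (a * b + dot u v) + (a′ * b + dot u′ v) ∎
  where open ≡-Reasoning

dot-⊛ˡ : ∀ {n} c (u v : Vec ℕ n) → dot (c ⊛ u) v ≡ c * dot u v
dot-⊛ˡ zero    u v = dot-zeroˡ v
dot-⊛ˡ (suc c) u v = dot-scaled u v
  where
  dot-scaled : ∀ {n} (u v : Vec ℕ n) → dot (Vec.map (suc c *_) u) v ≡ suc c * dot u v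
  dot-scaled []      []      = sym (*-zeroʳ c)
  dot-scaled (a ∷ u) (b ∷ v) = trans (cong₂ _+_ (*-assoc (suc c) a b) (dot-scaled u v))
                                     (sym (*-distribˡ-+ (suc c) (a * b) (dot u v)))

dot-rowCombination : ∀ {k n} (cs : Vec ℕ k) (rs : Vec (Vec ℕ n) k) v →
  dot (rowCombination cs rs) v ≡ dot cs (Vec.map (λ r → dot r v) rs)
dot-rowCombination []       []       v = dot-zeroˡ v
dot-rowCombination (c ∷ cs) (r ∷ rs) v =
  trans (dot-⊕ˡ (c ⊛ r) (rowCombination cs rs) v)
        (cong₂ _+_ (dot-⊛ˡ c r v) (dot-rowCombination cs rs v))

dot-linearRelation : ∀ {n} (u v w x y F : Vec ℕ n) → u ⊕ 6 ⊛ v ⊕ w ≡ 8 ⊛ x ⊕ 4 ⊛ y →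
  dot u F + 6 * dot v F + dot w F ≡ 8 * dot x F + 4 * dot y F
dot-linearRelation u v w x y F relation = begin
  dot u F + 6 * dot v F + dot w F   ≡⟨ cong (λ d → dot u F + d + dot w F) (dot-⊛ˡ 6 v F) ⟨
  dot u F + dot (6 ⊛ v) F + dot w F ≡⟨ cong (_+ dot w F) (dot-⊕ˡ u (6 ⊛ v) F) ⟨
  dot (u ⊕ 6 ⊛ v) F + dot w F       ≡⟨ dot-⊕ˡ (u ⊕ 6 ⊛ v) w F ⟨
  dot (u ⊕ 6 ⊛ v ⊕ w) F             ≡⟨ cong (λ z → dot z F) relation ⟩
  dot (8 ⊛ x ⊕ 4 ⊛ y) F             ≡⟨ dot-⊕ˡ (8 ⊛ x) (4 ⊛ y) F ⟩
  dot (8 ⊛ x) F + dot (4 ⊛ y) F     ≡⟨ cong₂ _+_ (dot-⊛ˡ 8 x F) (dot-⊛ˡ 4 y F) ⟩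
  8 * dot x F + 4 * dot y F ∎
  where open ≡-Reasoning

-- The transfer matrix

_≟ₛ_ : (s t : State) → _
_≟ₛ_ = ≡-decᴸ (≡-decᴸ Bool._≟_)

open import Data.Vec.Membership.DecPropositional _≟ₛ_ using (_∈?_)

-- In the state profile p₀ … p₆ the first pᵢ of the three cells of row i are
-- already covered, by a horizontal tile; these are the states reachable from
-- emptyState.
profile : ℕ → ℕ → ℕ → ℕ → ℕ → ℕ → ℕ → State
profile a b c d e f g = map (λ k → map (k ≤ᵇ_) (upTo 3)) (a ∷ b ∷ c ∷ d ∷ e ∷ f ∷ g ∷ [])

states : Vec State 52
states =
    profile 0 0 0 0 0 0 0 ∷ profile 3 3 3 3 3 3 3 ∷ profile 3 3 3 0 0 0 0 ∷ profile 3 3 0 0 0 0 3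
  ∷ profile 3 0 0 0 0 3 3 ∷ profile 0 0 0 0 3 3 3 ∷ profile 2 2 2 2 2 2 2 ∷ profile 2 2 2 3 3 3 3
  ∷ profile 2 2 2 0 0 0 0 ∷ profile 2 2 3 3 3 3 2 ∷ profile 2 2 0 0 0 0 2 ∷ profile 2 3 3 3 3 2 2
  ∷ profile 2 0 0 0 0 2 2 ∷ profile 3 3 3 3 2 2 2 ∷ profile 0 0 0 0 2 2 2 ∷ profile 1 1 1 1 1 1 1
  ∷ profile 1 1 1 2 2 2 2 ∷ profile 1 1 1 3 3 3 3 ∷ profile 1 1 1 0 0 0 0 ∷ profile 1 1 2 2 2 2 1
  ∷ profile 1 1 3 3 3 3 1 ∷ profile 1 1 0 0 0 0 1 ∷ profile 1 2 2 2 2 1 1 ∷ profile 1 3 3 3 3 1 1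
  ∷ profile 1 0 0 0 0 1 1 ∷ profile 2 2 2 2 1 1 1 ∷ profile 3 3 3 3 1 1 1 ∷ profile 0 0 0 0 1 1 1
  ∷ profile 0 0 0 1 1 1 1 ∷ profile 0 0 0 2 2 2 2 ∷ profile 0 0 0 3 3 3 3 ∷ profile 0 0 1 1 1 1 0
  ∷ profile 0 0 2 2 2 2 0 ∷ profile 0 0 3 3 3 3 0 ∷ profile 0 1 1 1 1 0 0 ∷ profile 0 2 2 2 2 0 0
  ∷ profile 0 3 3 3 3 0 0 ∷ profile 1 1 1 1 0 0 0 ∷ profile 2 2 2 2 0 0 0 ∷ profile 3 3 3 3 0 0 0
  ∷ profile 3 3 3 1 1 1 1 ∷ profile 3 3 3 2 2 2 2 ∷ profile 3 3 1 1 1 1 3 ∷ profile 3 3 2 2 2 2 3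
  ∷ profile 3 1 1 1 1 3 3 ∷ profile 3 2 2 2 2 3 3 ∷ profile 1 1 1 1 3 3 3 ∷ profile 2 2 2 2 3 3 3
  ∷ profile 2 2 2 1 1 1 1 ∷ profile 2 2 1 1 1 1 2 ∷ profile 2 1 1 1 1 2 2 ∷ profile 1 1 1 1 2 2 2
  ∷ []

emptyState∈states : emptyState ∈ states
emptyState∈states = here refl

successors-closed : VecAll.All (λ s → All (_∈ states) (successors 4 s)) states
successors-closed = from-yes (VecAll.all? (λ s → All.all? (_∈? states) (successors 4 s)) states)

indicator : ∀ {n} → State → Vec State n → Vec ℕ n
indicator s []       = []
indicator s (t ∷ ts) = if does (t ≟ₛ s) then 1 ∷ Vec.replicate _ 0 else 0 ∷ indicator s ts

dot-indicator : ∀ {n} (G : State → ℕ) {s} (ts : Vec State n) → s ∈ ts →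
  dot (indicator s ts) (Vec.map G ts) ≡ G s
dot-indicator G {s} (t ∷ ts) s∈t∷ts with t ≟ₛ s | s∈t∷ts
... | yes refl | _         =
  trans (cong (_+_ (G t + 0)) (dot-zeroˡ (Vec.map G ts))) (trans (+-identityʳ (G t + 0)) (+-identityʳ (G t)))
... | no t≢s   | here s≡t  = contradiction (sym s≡t) t≢s
... | no t≢s   | there s∈ = dot-indicator G ts s∈

coordinates : ∀ {n} → Vec State n → List State → Vec ℕ n
coordinates ts []       = Vec.replicate _ 0
coordinates ts (w ∷ ws) = indicator w ts ⊕ coordinates ts ws

dot-coordinates : ∀ {n} (G : State → ℕ) (ts : Vec State n) {ws} → All (_∈ ts) ws →
  dot (coordinates ts ws) (Vec.map G ts) ≡ sum (map G ws)
dot-coordinates G ts                []          = dot-zeroˡ (Vec.map G ts)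
dot-coordinates G ts {w ∷ ws} (w∈ ∷ ws∈) =
  trans (dot-⊕ˡ (indicator w ts) (coordinates ts ws) (Vec.map G ts))
        (cong₂ _+_ (dot-indicator G ts w∈) (dot-coordinates G ts ws∈))

-- For n ≥ 4, successors n evaluates to successors 4 (horizontal tiles fit).
transfer : Vec (Vec ℕ 52) 52
transfer = Vec.map (coordinates states ∘ successors 4) states

countVector : ℕ → Vec ℕ 52
countVector n = Vec.map (countColumns n) states

transfer-countVector : ∀ k → Vec.map (λ r → dot r (countVector (3 + k))) transfer ≡ countVector (4 + k)
transfer-countVector k =
  trans (sym (Vec.map-∘ (λ r → dot r (countVector (3 + k))) (coordinates states ∘ successors 4) states))
        (rows states successors-closed)
  where
  rows : ∀ {n} (ts : Vec State n) → VecAll.All (λ s → All (_∈ states) (successors 4 s)) ts →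
    Vec.map (λ s → dot (coordinates states (successors 4 s)) (countVector (3 + k))) ts
      ≡ Vec.map (countColumns (4 + k)) ts
  rows []       VecAll.[]          = refl
  rows (t ∷ ts) (closed VecAll.∷ closeds) =
    cong₂ _∷_ (dot-coordinates (countColumns (3 + k)) states closed) (rows ts closeds)

-- Opaque, so that the type checker compares the arguments of rowPower and of
-- tilingCount instead of evaluating them; evaluating tilingCount is an exhaustive
-- search.
opaque
  rowPower : ℕ → Vec ℕ 52
  rowPower zero    = indicator emptyState states
  rowPower (suc j) = rowCombination (rowPower j) transfer

  countColumns-rowPower : ∀ j k →
    countColumns (j + (3 + k)) emptyState ≡ dot (rowPower j) (countVector (3 + k))
  countColumns-rowPower zero    k = sym (dot-indicator (countColumns (3 + k)) states emptyState∈states)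
  countColumns-rowPower (suc j) k = begin
    countColumns (suc j + (3 + k)) emptyState
      ≡⟨ cong (λ n → countColumns n emptyState) (+-suc j (3 + k)) ⟨
    countColumns (j + (3 + suc k)) emptyState
      ≡⟨ countColumns-rowPower j (suc k) ⟩
    dot (rowPower j) (countVector (4 + k))
      ≡⟨ cong (dot (rowPower j)) (transfer-countVector k) ⟨
    dot (rowPower j) (Vec.map (λ r → dot r (countVector (3 + k))) transfer)
      ≡⟨ dot-rowCombination (rowPower j) transfer (countVector (3 + k)) ⟨
    dot (rowPower (suc j)) (countVector (3 + k)) ∎
    where open ≡-Reasoning

  rowPower-relation : rowPower 17 ⊕ 6 ⊛ rowPower 9 ⊕ rowPower 1 ≡ 8 ⊛ rowPower 13 ⊕ 4 ⊛ rowPower 5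
  rowPower-relation = refl

opaque
  tilingCount : ℕ → ℕ
  tilingCount k = countColumns (4 * k) emptyState

  tilingCount-0 : tilingCount 0 ≡ 1
  tilingCount-0 = refl

  numTilings≡tilingCount : ∀ k → numTilings 7 (4 * k) 1 4 ≡ tilingCount k
  numTilings≡tilingCount k = numTilings≡countColumns (4 * k)

  tilingCount-rowPower : ∀ i k → tilingCount (i + suc k) ≡ dot (rowPower (1 + 4 * i)) (countVector (3 + 4 * k))
  tilingCount-rowPower i k =
    trans (cong (λ n → countColumns n emptyState) (columns i k)) (countColumns-rowPower (1 + 4 * i) (4 * k))
    where
    columns : ∀ i k → 4 * (i + (1 + k)) ≡ (1 + 4 * i) + (3 + 4 * k)
    columns = solve-∀

opaque
  unfolding rowPower

  tilingCount-1 : tilingCount 1 ≡ 5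
  tilingCount-1 = tilingCount-rowPower 0 0

  tilingCount-2 : tilingCount 2 ≡ 37
  tilingCount-2 = tilingCount-rowPower 1 0

  tilingCount-3 : tilingCount 3 ≡ 269
  tilingCount-3 = tilingCount-rowPower 2 0

  tilingCount-4 : tilingCount 4 ≡ 1949
  tilingCount-4 = tilingCount-rowPower 3 0

tilingCount-recurrence : ∀ k → tilingCount (4 + k) + 6 * tilingCount (2 + k) + tilingCount k
                               ≡ 8 * tilingCount (3 + k) + 4 * tilingCount (1 + k)
tilingCount-recurrence zero =
  trans (cong₂ _+_ (cong₂ (λ a b → a + 6 * b) tilingCount-4 tilingCount-2) tilingCount-0)
        (sym (cong₂ (λ a b → 8 * a + 4 * b) tilingCount-3 tilingCount-1))
tilingCount-recurrence (suc k) = begin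
  tilingCount (4 + suc k) + 6 * tilingCount (2 + suc k) + tilingCount (0 + suc k)
    ≡⟨ cong₂ _+_ (cong₂ (λ a b → a + 6 * b) (tilingCount-rowPower 4 k) (tilingCount-rowPower 2 k))
                 (tilingCount-rowPower 0 k) ⟩
  dot (rowPower 17) F + 6 * dot (rowPower 9) F + dot (rowPower 1) F
    ≡⟨ dot-linearRelation (rowPower 17) (rowPower 9) (rowPower 1) (rowPower 13) (rowPower 5) F rowPower-relation ⟩
  8 * dot (rowPower 13) F + 4 * dot (rowPower 5) F
    ≡⟨ cong₂ (λ a b → 8 * a + 4 * b) (tilingCount-rowPower 3 k) (tilingCount-rowPower 1 k) ⟨
  8 * tilingCount (3 + suc k) + 4 * tilingCount (1 + suc k) ∎
  where
  open ≡-Reasoning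
  F : Vec ℕ 52
  F = countVector (3 + 4 * k)

aSeq-multiple : ∀ q → aSeq (q * 7) ≡ tilingCount q
aSeq-multiple zero    = sym tilingCount-0
aSeq-multiple (suc q) = begin
  (if (4 * (suc q * 7)) % 7 ≡ᵇ 0 then numTilings 7 ((4 * (suc q * 7)) / 7) 1 4 else 0)
    ≡⟨ cong (λ m → if m % 7 ≡ᵇ 0 then numTilings 7 (m / 7) 1 4 else 0) (*-assoc 4 (suc q) 7) ⟨
  (if (4 * suc q * 7) % 7 ≡ᵇ 0 then numTilings 7 ((4 * suc q * 7) / 7) 1 4 else 0)
    ≡⟨ cong₂ (λ r m → if r ≡ᵇ 0 then numTilings 7 m 1 4 else 0) (m*n%n≡0 (4 * suc q) 7) (m*n/n≡m (4 * suc q) 7) ⟩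
  numTilings 7 (4 * suc q) 1 4
    ≡⟨ numTilings≡tilingCount (suc q) ⟩
  tilingCount (suc q) ∎
  where open ≡-Reasoning

aSeq-nonmultiple : ∀ r q → suc r < 7 → aSeq (suc r + q * 7) ≡ 0
aSeq-nonmultiple r q r<6 =
  cong (λ b → if b then numTilings 7 ((4 * (suc r + q * 7)) / 7) 1 4 else 0)
       (trans (cong (_≡ᵇ 0) remainder) (residue r r<6))
  where
  remainder : (4 * (suc r + q * 7)) % 7 ≡ (4 * suc r) % 7
  remainder = trans (cong (_% 7) (distribute (suc r) q)) ([m+kn]%n≡m%n (4 * suc r) (4 * q) 7)
    where
    distribute : ∀ r q → 4 * (r + q * 7) ≡ 4 * r + 4 * q * 7
    distribute = solve-∀
  residue : ∀ r → suc r < 7 → ((4 * suc r) % 7 ≡ᵇ 0) ≡ false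
  residue 0 _ = refl
  residue 1 _ = refl
  residue 2 _ = refl
  residue 3 _ = refl
  residue 4 _ = refl
  residue 5 _ = refl
  residue (suc (suc (suc (suc (suc (suc r)))))) (s≤s (s≤s (s≤s (s≤s (s≤s (s≤s (s≤s ())))))))

aSeq-formula : ∀ i m → aSeq (i * 7 + m) ≡ (if m % 7 ≡ᵇ 0 then tilingCount (i + m / 7) else 0)
aSeq-formula i m =
  trans (cong aSeq (trans (cong (_+_ (i * 7)) (m≡m%n+[m/n]*n m 7)) (regroup i (m % 7) (m / 7))))
        (decomposed (m % 7) (m%n<n m 7))
  where
  regroup : ∀ i r q → i * 7 + (r + q * 7) ≡ r + (i + q) * 7
  regroup = solve-∀
  decomposed : ∀ r → r < 7 → aSeq (r + (i + m / 7) * 7) ≡ (if r ≡ᵇ 0 then tilingCount (i + m / 7) else 0)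
  decomposed zero    _   = aSeq-multiple (i + m / 7)
  decomposed (suc r) r<7 = aSeq-nonmultiple r (i + m / 7) r<7

aSeq-recurrence : ∀ m → aSeq (28 + m) + 6 * aSeq (14 + m) + aSeq m ≡ 8 * aSeq (21 + m) + 4 * aSeq (7 + m)
aSeq-recurrence m = begin
  aSeq (28 + m) + 6 * aSeq (14 + m) + aSeq m
    ≡⟨ cong₂ _+_ (cong₂ (λ a b → a + 6 * b) (aSeq-formula 4 m) (aSeq-formula 2 m)) (aSeq-formula 0 m) ⟩
  term divisible 4 + 6 * term divisible 2 + term divisible 0
    ≡⟨ on-multiples divisible ⟩
  8 * term divisible 3 + 4 * term divisible 1
    ≡⟨ cong₂ (λ x y → 8 * x + 4 * y) (aSeq-formula 3 m) (aSeq-formula 1 m) ⟨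
  8 * aSeq (21 + m) + 4 * aSeq (7 + m) ∎
  where
  open ≡-Reasoning
  divisible : Bool
  divisible = m % 7 ≡ᵇ 0
  term : Bool → ℕ → ℕ
  term b i = if b then tilingCount (i + m / 7) else 0
  on-multiples : ∀ b → term b 4 + 6 * term b 2 + term b 0 ≡ 8 * term b 3 + 4 * term b 1
  on-multiples true  = tilingCount-recurrence (m / 7)
  on-multiples false = refl

-- The generating function

sumTo-cong : ∀ n {f g : ℕ → ℤ} → (∀ i → f i ≡ g i) → sumTo n f ≡ sumTo n g
sumTo-cong zero    f≗g = f≗g 0
sumTo-cong (suc n) f≗g = cong₂ ℤ._+_ (sumTo-cong n f≗g) (f≗g (suc n))

sumTo-tail : ∀ n m (f : ℕ → ℤ) → (∀ i → f (suc (n + i)) ≡ + 0) → sumTo (n + m) f ≡ sumTo n f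
sumTo-tail n zero    f vanish = cong (λ k → sumTo k f) (+-identityʳ n)
sumTo-tail n (suc m) f vanish = begin
  sumTo (n + suc m) f                    ≡⟨ cong (λ k → sumTo k f) (+-suc n m) ⟩
  sumTo (n + m) f ℤ.+ f (suc (n + m))    ≡⟨ cong (ℤ._+_ (sumTo (n + m) f)) (vanish m) ⟩
  sumTo (n + m) f ℤ.+ + 0                ≡⟨ ℤ.+-identityʳ (sumTo (n + m) f) ⟩
  sumTo (n + m) f                        ≡⟨ sumTo-tail n m f vanish ⟩
  sumTo n f ∎
  where open ≡-Reasoning

VanishAfter : ℕ → ℕ → (ℕ → ℤ) → Set
VanishAfter zero    k f = ⊤
VanishAfter (suc d) k f = f (suc (d + k)) ≡ + 0 × VanishAfter d k f

sumTo-skip : ∀ d k f → VanishAfter d k f → sumTo (d + k) f ≡ sumTo k f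
sumTo-skip zero    k f _               = refl
sumTo-skip (suc d) k f (vanish , rest) =
  trans (cong (ℤ._+_ (sumTo (d + k) f)) vanish) (trans (ℤ.+-identityʳ _) (sumTo-skip d k f rest))

mulCoeff-denom : ∀ (B : ℕ → ℤ) m → mulCoeff (coeff denom) B (28 + m)
  ≡ + 1 ℤ.* B (28 + m) ℤ.+ - (+ 8) ℤ.* B (21 + m) ℤ.+ + 6 ℤ.* B (14 + m) ℤ.+ - (+ 4) ℤ.* B (7 + m) ℤ.+ + 1 ℤ.* B m
mulCoeff-denom B m =
  trans (sumTo-tail 28 m f (λ _ → refl))
        (cong (ℤ._+ f 28) (trans (skip 21 zeros) (cong (ℤ._+ f 21) (trans (skip 14 zeros)
          (cong (ℤ._+ f 14) (trans (skip 7 zeros) (cong (ℤ._+ f 7) (skip 0 zeros))))))))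
  where
  f : ℕ → ℤ
  f i = coeff denom i ℤ.* B (28 + m ∸ i)
  skip : ∀ k → VanishAfter 6 k f → sumTo (6 + k) f ≡ sumTo k f
  skip k = sumTo-skip 6 k f
  -- coeff denom vanishes strictly between multiples of 7, so these six terms
  -- evaluate to + 0.
  pattern zeros = refl , refl , refl , refl , refl , refl , tt

denominator-annihilates : ∀ x₀ x₇ x₁₄ x₂₁ x₂₈ → x₂₈ + 6 * x₁₄ + x₀ ≡ 8 * x₂₁ + 4 * x₇ →
  + 1 ℤ.* + x₂₈ ℤ.+ - (+ 8) ℤ.* + x₂₁ ℤ.+ + 6 ℤ.* + x₁₄ ℤ.+ - (+ 4) ℤ.* + x₇ ℤ.+ + 1 ℤ.* + x₀ ≡ + 0
denominator-annihilates x₀ x₇ x₁₄ x₂₁ x₂₈ recurrence = begin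
  + 1 ℤ.* + x₂₈ ℤ.+ - (+ 8) ℤ.* + x₂₁ ℤ.+ + 6 ℤ.* + x₁₄ ℤ.+ - (+ 4) ℤ.* + x₇ ℤ.+ + 1 ℤ.* + x₀
    ≡⟨ regroup (+ x₀) (+ x₇) (+ x₁₄) (+ x₂₁) (+ x₂₈) ⟩
  (+ x₂₈ ℤ.+ + 6 ℤ.* + x₁₄ ℤ.+ + x₀) ℤ.- (+ 8 ℤ.* + x₂₁ ℤ.+ + 4 ℤ.* + x₇)
    ≡⟨ cong₂ ℤ._-_ lhs rhs ⟨
  + (x₂₈ + 6 * x₁₄ + x₀) ℤ.- + (8 * x₂₁ + 4 * x₇)
    ≡⟨ cong (λ n → + n ℤ.- + (8 * x₂₁ + 4 * x₇)) recurrence ⟩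
  + (8 * x₂₁ + 4 * x₇) ℤ.- + (8 * x₂₁ + 4 * x₇)
    ≡⟨ ℤ.+-inverseʳ (+ (8 * x₂₁ + 4 * x₇)) ⟩
  + 0 ∎
  where
  open ≡-Reasoning
  regroup : ∀ a b c d e → + 1 ℤ.* e ℤ.+ - (+ 8) ℤ.* d ℤ.+ + 6 ℤ.* c ℤ.+ - (+ 4) ℤ.* b ℤ.+ + 1 ℤ.* a
                          ≡ (e ℤ.+ + 6 ℤ.* c ℤ.+ a) ℤ.- (+ 8 ℤ.* d ℤ.+ + 4 ℤ.* b)
  regroup = ℤ-Solver.solve-∀
  lhs : + (x₂₈ + 6 * x₁₄ + x₀) ≡ + x₂₈ ℤ.+ + 6 ℤ.* + x₁₄ ℤ.+ + x₀
  lhs = trans (ℤ.pos-+ (x₂₈ + 6 * x₁₄) x₀)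
              (cong (ℤ._+ + x₀) (trans (ℤ.pos-+ x₂₈ (6 * x₁₄)) (cong (ℤ._+_ (+ x₂₈)) (ℤ.pos-* 6 x₁₄))))
  rhs : + (8 * x₂₁ + 4 * x₇) ≡ + 8 ℤ.* + x₂₁ ℤ.+ + 4 ℤ.* + x₇
  rhs = trans (ℤ.pos-+ (8 * x₂₁) (4 * x₇)) (cong₂ ℤ._+_ (ℤ.pos-* 8 x₂₁) (ℤ.pos-* 4 x₇))

series-from-28 : ∀ m → mulCoeff (coeff denom) A (28 + m) ≡ coeff numer (28 + m)
series-from-28 m =
  trans (mulCoeff-denom A m)
        (denominator-annihilates (aSeq m) (aSeq (7 + m)) (aSeq (14 + m)) (aSeq (21 + m)) (aSeq (28 + m))
                                 (aSeq-recurrence m))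

initialCounts : List ℕ
initialCounts = 1 ∷ 5 ∷ 37 ∷ 269 ∷ []

-- A with its first values tabulated, so that its coefficients below 28 can be
-- evaluated.
A₀ : ℕ → ℤ
A₀ k = + (if k % 7 ≡ᵇ 0 then lookupOr 0 initialCounts (k / 7) else 0)

A≡A₀ : ∀ k → k < 28 → A k ≡ A₀ k
A≡A₀ k k<28 =
  cong +_ (trans (aSeq-formula 0 k) (cong (if k % 7 ≡ᵇ 0 then_else 0) (initial (k / 7) (m<n*o⇒m/o<n k<28))))
  where
  initial : ∀ q → q < 4 → tilingCount q ≡ lookupOr 0 initialCounts q
  initial 0 _ = tilingCount-0
  initial 1 _ = tilingCount-1
  initial 2 _ = tilingCount-2
  initial 3 _ = tilingCount-3
  initial (suc (suc (suc (suc q)))) (s≤s (s≤s (s≤s (s≤s ()))))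

series₀-below-28 : ∀ (i : Fin 28) → mulCoeff (coeff denom) A₀ (toℕ i) ≡ coeff numer (toℕ i)
series₀-below-28 =
  from-yes (Fin.all? λ (i : Fin 28) → mulCoeff (coeff denom) A₀ (toℕ i) ℤ.≟ coeff numer (toℕ i))

series-below-28 : ∀ n → n < 28 → mulCoeff (coeff denom) A n ≡ coeff numer n
series-below-28 n n<28 = begin
  mulCoeff (coeff denom) A n
    ≡⟨ sumTo-cong n (λ i → cong (coeff denom i ℤ.*_) (A≡A₀ (n ∸ i) (≤-<-trans (m∸n≤m n i) n<28))) ⟩
  mulCoeff (coeff denom) A₀ n
    ≡⟨ subst (λ k → mulCoeff (coeff denom) A₀ k ≡ coeff numer k) (Fin.toℕ-fromℕ< n<28)
             (series₀-below-28 (fromℕ< n<28)) ⟩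
  coeff numer n ∎
  where open ≡-Reasoning

series : ∀ n → mulCoeff (coeff denom) A n ≡ coeff numer n
series n with n <? 28
... | yes n<28 = series-below-28 n n<28
... | no  n≮28 = beyond (m≤n⇒∃[o]m+o≡n (≮⇒≥ n≮28))
  where
  beyond : (∃ λ m → 28 + m ≡ n) → mulCoeff (coeff denom) A n ≡ coeff numer n
  beyond (m , 28+m≡n) = subst (λ k → mulCoeff (coeff denom) A k ≡ coeff numer k) 28+m≡n (series-from-28 m)

mainTheorem6 : ((n : ℕ) → mulCoeff (coeff denom) A n ≡ coeff numer n)
    × (aSeq 0 ≡ 1) × (aSeq 7 ≡ 5) × (aSeq 14 ≡ 37) × (aSeq 21 ≡ 269) × (aSeq 28 ≡ 1949)
mainTheorem6 =
  series , refl , value 7 1 refl tilingCount-1 , value 14 2 refl tilingCount-2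
         , value 21 3 refl tilingCount-3 , value 28 4 refl tilingCount-4
  where
  value : ∀ n q {c} → n ≡ q * 7 → tilingCount q ≡ c → aSeq n ≡ c
  value n q n≡7q t≡c = trans (cong aSeq n≡7q) (trans (aSeq-multiple q) t≡c)
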